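{- Let $k\ge1$ and $n_1,\ldots,n_k\ge 2$. The radius of $H_{n_1,\ldots,n_k}$ equals the eccentricity of its root $r=0^k$, namely $k$, and the diameter of $H_{n_1,\ldots,n_k}$ equals $2k-1$.
   Context: For integers $n_1,\ldots,n_k\ge 2$, $H_{n_1,\ldots,n_k}$ is the simple graph on the strings $x=x_1\cdots x_k$ with $x_i\in\mathbb{Z}_{n_i}=\{0,\ldots,n_i-1\}$, where, writing $0^m$ for $m$ zeros and $w$ for a possibly empty common suffix, two distinct vertices are adjacent iff: (A0) $x=a\,w$, $y=b\,w$ with $a\neq b$; or (A1) for some $1\le m\le k$, $x=0^m w$ and $y=c_1\cdots c_m w$ with all $c_j\neq0$, or vice versa; or (A2) for some $1\le i\le k$, $x=0^{i-1}a\,w$, $y=0^{i-1}b\,w$ with $a,b\neq 0$, $a\ne b$. The root is $r=0^k$. The eccentricity of a vertex is the maximum distance from it to any vertex; the radius and diameter are the minimum and maximum eccentricities. -}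

module Defs where

open import Data.Nat using (ℕ; zero; suc; _≤_; _<_)
open import Data.List using (List; []; _∷_; _++_; length; replicate)
open import Data.List.Relation.Unary.All using (All)
open import Data.List.Relation.Binary.Pointwise using (Pointwise)
open import Data.Product using (Σ; ∃; _×_; _,_)
open import Data.Sum using (_⊎_)
open import Relation.Binary.PropositionalEquality using (_≡_; _≢_)
open import Relation.Nullary using (¬_)

-- A string x = x₁ ⋯ x_k is a list of naturals; it is a vertex of
-- H_{n₁,…,n_k} (with ns = n₁ ∷ … ∷ n_k) iff xᵢ < nᵢ for every i.
IsVertex : List ℕ → List ℕ → Set
IsVertex ns x = Pointwise _<_ x ns

A0 : List ℕ → List ℕ → Set
A0 a b = Σ ℕ λ p → Σ ℕ λ q → a ≡ p ∷ [] × b ≡ q ∷ [] × p ≢ q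

A1half : List ℕ → List ℕ → Set
A1half a b = 1 ≤ length a × length a ≡ length b × All (_≡ 0) a × All (_≢ 0) b

A1 : List ℕ → List ℕ → Set
A1 a b = A1half a b ⊎ A1half b a

A2 : List ℕ → List ℕ → Set
A2 a b = Σ ℕ λ j → Σ ℕ λ p → Σ ℕ λ q →
  a ≡ replicate j 0 ++ (p ∷ []) × b ≡ replicate j 0 ++ (q ∷ []) ×
  p ≢ 0 × q ≢ 0 × p ≢ q

Adj : List ℕ → List ℕ → Set
Adj x y = x ≢ y × Σ (List ℕ) λ a → Σ (List ℕ) λ b → Σ (List ℕ) λ w →
  x ≡ a ++ w × y ≡ b ++ w × (A0 a b ⊎ A1 a b ⊎ A2 a b)

-- Walks of length d from x to y in H_ns (all vertices after x are vertices of H).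
data Walk (ns : List ℕ) : ℕ → List ℕ → List ℕ → Set where
  here : ∀ {x} → Walk ns zero x x
  step : ∀ {d x y z} → Adj x y → IsVertex ns y → Walk ns d y z → Walk ns (suc d) x z

IsDist : List ℕ → List ℕ → List ℕ → ℕ → Set
IsDist ns x y d = Walk ns d x y × (∀ d′ → d′ < d → ¬ Walk ns d′ x y)

IsEcc : List ℕ → List ℕ → ℕ → Set
IsEcc ns x e =
  (∀ y → IsVertex ns y → Σ ℕ λ d → d ≤ e × IsDist ns x y d) ×
  (Σ (List ℕ) λ y → IsVertex ns y × IsDist ns x y e)

IsRadius : List ℕ → ℕ → Set
IsRadius ns R =
  (Σ (List ℕ) λ x → IsVertex ns x × IsEcc ns x R) ×
  (∀ x e → IsVertex ns x → IsEcc ns x e → R ≤ e)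

IsDiameter : List ℕ → ℕ → Set
IsDiameter ns D =
  (Σ (List ℕ) λ x → IsVertex ns x × IsEcc ns x D) ×
  (∀ x e → IsVertex ns x → IsEcc ns x e → e ≤ D)

root : List ℕ → List ℕ
root ns = replicate (length ns) 0

-- The height of a string, i.e. the number of switches between zero and
-- non-zero letters in x·0, is its distance to the root: a walk from the root
-- rewrites, from the right, the prefix ending at each switch to 0^i and back
-- to a string of non-zero letters.  Every edge changes the height by at most
-- one, and an edge that changes whether the last letter is zero must rewrite
-- the whole string, so one of its ends is the root.  Hence two strings of which
-- exactly one ends in 0 are at distance at least the sum of their heights.
-- The zigzag strings …0101 (height k) and …1010 (height k − 1) thus show that
-- every eccentricity is at least k and that the diameter is at least 2k − 1.
-- Conversely, if x and y agree after position i, they are joined through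
-- 0^i·w, or through 0^(i−1)·xᵢ·w and 0^(i−1)·yᵢ·w, in at most 2i − 1 steps.
module Submission where

open import Defs
open import Data.Bool using (Bool; true; false; not)
open import Data.Empty using (⊥; ⊥-elim)
open import Data.List
  using (List; []; _∷_; _++_; length; replicate; map; take; drop; reverse; _ʳ++_)
open import Data.List.Properties
  using (++-assoc; ++-identityʳ; ++-cancelˡ; ++-cancelʳ; ∷-injectiveˡ; ∷-injectiveʳ;
         length-++; length-ʳ++; length-map; length-replicate; length-reverse;
         reverse-involutive; take++drop≡id; ≡-dec)
open import Data.List.Relation.Unary.All using (All; []; _∷_; all?; universal)
  renaming (map to All-map)
open import Data.List.Relation.Unary.All.Properties using (replicate⁺; map⁺)
open import Data.List.Relation.Binary.Pointwise
  using (Pointwise; []; _∷_; Pointwise-length; ʳ++⁺) renaming (refl to Pointwise-refl)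
open import Data.Nat using (ℕ; zero; suc; _+_; _*_; _∸_; _≤_; _<_; z≤n; s≤s; _≟_; _≤?_)
open import Data.Nat.Induction using (<-rec)
open import Data.Nat.Properties
open import Data.Product using (Σ; _×_; _,_; proj₁; proj₂)
open import Data.Sum using (_⊎_; inj₁; inj₂)
open import Relation.Binary.PropositionalEquality
open import Relation.Nullary using (¬_; Dec; yes; no)
open import Relation.Nullary.Decidable using (_×-dec_; _⊎-dec_; ¬?; map′)

Move : List ℕ → List ℕ → Set
Move a b = A0 a b ⊎ A1 a b ⊎ A2 a b

isZero : ℕ → Bool
isZero zero    = true
isZero (suc _) = false

isZero-≢0 : ∀ {x} → x ≢ 0 → isZero x ≡ false
isZero-≢0 {zero}  x≢0 = ⊥-elim (x≢0 refl)
isZero-≢0 {suc x} _   = refl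

differ : Bool → Bool → ℕ
differ true  true  = 0
differ false false = 0
differ true  false = 1
differ false true  = 1

differ≤1 : ∀ a b → differ a b ≤ 1
differ≤1 true  true  = z≤n
differ≤1 false false = z≤n
differ≤1 true  false = s≤s z≤n
differ≤1 false true  = s≤s z≤n

differ-self : ∀ a → differ a a ≡ 0
differ-self true  = refl
differ-self false = refl

headIsZero : List ℕ → Bool
headIsZero []      = true
headIsZero (x ∷ _) = isZero x

height : List ℕ → ℕ
height []      = 0
height (x ∷ u) = differ (isZero x) (headIsZero u) + height u

-- changesʳ b r counts the switches in reverse r · c, for a letter c of zero-ness b.
changesʳ : Bool → List ℕ → ℕ
changesʳ b []      = 0
changesʳ b (x ∷ r) = differ (isZero x) b + changesʳ (isZero x) r

height-ʳ++ : ∀ r w → height (r ʳ++ w) ≡ changesʳ (headIsZero w) r + height w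
height-ʳ++ []      w = refl
height-ʳ++ (x ∷ r) w = begin
  height (r ʳ++ x ∷ w)                    ≡⟨ height-ʳ++ r (x ∷ w) ⟩
  changesʳ (isZero x) r + (δ + height w)  ≡⟨ sym (+-assoc (changesʳ (isZero x) r) δ _) ⟩
  changesʳ (isZero x) r + δ + height w    ≡⟨ cong (_+ height w) (+-comm (changesʳ (isZero x) r) δ) ⟩
  δ + changesʳ (isZero x) r + height w    ∎
  where
  open ≡-Reasoning
  δ : ℕ
  δ = differ (isZero x) (headIsZero w)

height-reverse : ∀ r → height (reverse r) ≡ changesʳ true r
height-reverse r = trans (height-ʳ++ r []) (+-identityʳ _)

height≤length : ∀ u → height u ≤ length u
height≤length []      = z≤n
height≤length (x ∷ u) = +-mono-≤ (differ≤1 (isZero x) (headIsZero u)) (height≤length u)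

changesʳ≤length : ∀ b r → changesʳ b r ≤ length r
changesʳ≤length b []      = z≤n
changesʳ≤length b (x ∷ r) = +-mono-≤ (differ≤1 (isZero x) b) (changesʳ≤length (isZero x) r)

height-zeros : ∀ {u} → All (_≡ 0) u → height u ≡ 0
height-zeros []                  = refl
height-zeros (refl ∷ [])         = refl
height-zeros (refl ∷ refl ∷ u≡0) = height-zeros (refl ∷ u≡0)

lastIsZeroOr : Bool → List ℕ → Bool
lastIsZeroOr b []      = b
lastIsZeroOr b (x ∷ u) = lastIsZeroOr (isZero x) u

endsInZero : List ℕ → Bool
endsInZero = lastIsZeroOr true

lastIsZeroOr-++ : ∀ b a w → lastIsZeroOr b (a ++ w) ≡ lastIsZeroOr (lastIsZeroOr b a) w
lastIsZeroOr-++ b []      w = refl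
lastIsZeroOr-++ b (x ∷ a) w = lastIsZeroOr-++ (isZero x) a w

lastIsZeroOr-ʳ++ : ∀ b r x w → lastIsZeroOr b (r ʳ++ x ∷ w) ≡ lastIsZeroOr (isZero x) w
lastIsZeroOr-ʳ++ b []      x w = refl
lastIsZeroOr-ʳ++ b (y ∷ r) x w = lastIsZeroOr-ʳ++ b r y (x ∷ w)

endsInZero≡false⇒1≤height : ∀ u → endsInZero u ≡ false → 1 ≤ height u
endsInZero≡false⇒1≤height (suc x ∷ []) _  = s≤s z≤n
endsInZero≡false⇒1≤height (x ∷ y ∷ u) eu =
  ≤-trans (endsInZero≡false⇒1≤height (y ∷ u) eu) (m≤n+m _ (differ (isZero x) (isZero y)))

-- Height is 1-Lipschitz along edges

Homogeneous : Bool → List ℕ → Set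
Homogeneous β = All (λ z → isZero z ≡ β)

height-homogeneous-++ : ∀ β x a w → Homogeneous β (x ∷ a) →
                        height ((x ∷ a) ++ w) ≡ differ β (headIsZero w) + height w
height-homogeneous-++ β x []      w (refl ∷ [])   = refl
height-homogeneous-++ β x (y ∷ a) w (x≡β ∷ y≡β ∷ a≡β) =
  cong₂ _+_ (trans (cong₂ differ x≡β y≡β) (differ-self β))
            (height-homogeneous-++ β y a w (y≡β ∷ a≡β))

height-homogeneous-bounds : ∀ {β} a w → 1 ≤ length a → Homogeneous β a →
                            height w ≤ height (a ++ w) × height (a ++ w) ≤ suc (height w)
height-homogeneous-bounds {β} (x ∷ a) w _ h rewrite height-homogeneous-++ β x a w h =
  m≤n+m (height w) _ , +-monoˡ-≤ (height w) (differ≤1 β (headIsZero w))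

height-homogeneous-step : ∀ {β γ} a b w → 1 ≤ length a → 1 ≤ length b →
                          Homogeneous β a → Homogeneous γ b → height (b ++ w) ≤ suc (height (a ++ w))
height-homogeneous-step a b w 1≤∣a∣ 1≤∣b∣ ha hb =
  ≤-trans (proj₂ (height-homogeneous-bounds b w 1≤∣b∣ hb))
          (s≤s (proj₁ (height-homogeneous-bounds a w 1≤∣a∣ ha)))

zeros-homogeneous : ∀ {a} → All (_≡ 0) a → Homogeneous true a
zeros-homogeneous = All-map λ { refl → refl }

nonzeros-homogeneous : ∀ {a} → All (_≢ 0) a → Homogeneous false a
nonzeros-homogeneous = All-map isZero-≢0

SamePattern : List ℕ → List ℕ → Set
SamePattern = Pointwise (λ p q → isZero p ≡ isZero q)

headIsZero-samePattern-++ : ∀ {a b} w → SamePattern a b → headIsZero (a ++ w) ≡ headIsZero (b ++ w)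
headIsZero-samePattern-++ w []      = refl
headIsZero-samePattern-++ w (e ∷ _) = e

height-samePattern-++ : ∀ {a b} w → SamePattern a b → height (a ++ w) ≡ height (b ++ w)
height-samePattern-++ w []      = refl
height-samePattern-++ w (e ∷ s) =
  cong₂ _+_ (cong₂ differ e (headIsZero-samePattern-++ w s)) (height-samePattern-++ w s)

A2-samePattern : ∀ {a b} → A2 a b → SamePattern a b
A2-samePattern (j , p , q , refl , refl , p≢0 , q≢0 , _) = go j
  where
  go : ∀ i → SamePattern (replicate i 0 ++ p ∷ []) (replicate i 0 ++ q ∷ [])
  go zero    = trans (isZero-≢0 p≢0) (sym (isZero-≢0 q≢0)) ∷ []
  go (suc i) = refl ∷ go i

height-move-++ : ∀ a b w → Move a b → height (b ++ w) ≤ suc (height (a ++ w))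
height-move-++ (p ∷ []) (q ∷ []) w (inj₁ (_ , _ , refl , refl , _)) =
  height-homogeneous-step (p ∷ []) (q ∷ []) w (s≤s z≤n) (s≤s z≤n) (refl ∷ []) (refl ∷ [])
height-move-++ a b w (inj₂ (inj₁ (inj₁ (1≤∣a∣ , ∣a∣≡∣b∣ , a≡0 , b≢0)))) =
  height-homogeneous-step a b w 1≤∣a∣ (≤-trans 1≤∣a∣ (≤-reflexive ∣a∣≡∣b∣))
    (zeros-homogeneous a≡0) (nonzeros-homogeneous b≢0)
height-move-++ a b w (inj₂ (inj₁ (inj₂ (1≤∣b∣ , ∣b∣≡∣a∣ , b≡0 , a≢0)))) =
  height-homogeneous-step a b w (≤-trans 1≤∣b∣ (≤-reflexive ∣b∣≡∣a∣)) 1≤∣b∣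
    (nonzeros-homogeneous a≢0) (zeros-homogeneous b≡0)
height-move-++ a b w (inj₂ (inj₂ a~b)) =
  ≤-trans (≤-reflexive (sym (height-samePattern-++ w (A2-samePattern a~b)))) (n≤1+n _)

height-lipschitz : ∀ {x y} → Adj x y → height y ≤ suc (height x)
height-lipschitz (_ , a , b , w , refl , refl , mv) = height-move-++ a b w mv

adj-sym : ∀ {x y} → Adj x y → Adj y x
adj-sym (x≢y , a , b , w , ex , ey , inj₁ (p , q , ea , eb , p≢q)) =
  ≢-sym x≢y , b , a , w , ey , ex , inj₁ (q , p , eb , ea , ≢-sym p≢q)
adj-sym (x≢y , a , b , w , ex , ey , inj₂ (inj₁ (inj₁ h))) =
  ≢-sym x≢y , b , a , w , ey , ex , inj₂ (inj₁ (inj₂ h))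
adj-sym (x≢y , a , b , w , ex , ey , inj₂ (inj₁ (inj₂ h))) =
  ≢-sym x≢y , b , a , w , ey , ex , inj₂ (inj₁ (inj₁ h))
adj-sym (x≢y , a , b , w , ex , ey , inj₂ (inj₂ (j , p , q , ea , eb , p≢0 , q≢0 , p≢q))) =
  ≢-sym x≢y , b , a , w , ey , ex , inj₂ (inj₂ (j , q , p , eb , ea , q≢0 , p≢0 , ≢-sym p≢q))

adj-A1 : ∀ a b w → 1 ≤ length a → length a ≡ length b →
         All (_≡ 0) a → All (_≢ 0) b → Adj (a ++ w) (b ++ w)
adj-A1 a b w 1≤∣a∣ ∣a∣≡∣b∣ a≡0 b≢0 =
  (λ e → first-differs 1≤∣a∣ a≡0 b≢0 (++-cancelʳ w a b e)) ,
  a , b , w , refl , refl , inj₂ (inj₁ (inj₁ (1≤∣a∣ , ∣a∣≡∣b∣ , a≡0 , b≢0)))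
  where
  first-differs : ∀ {a b} → 1 ≤ length a → All (_≡ 0) a → All (_≢ 0) b → a ≢ b
  first-differs _ (refl ∷ _) (0≢0 ∷ _) refl = 0≢0 refl

adj-A2 : ∀ j p q w → p ≢ 0 → q ≢ 0 → p ≢ q →
         Adj (replicate j 0 ++ p ∷ w) (replicate j 0 ++ q ∷ w)
adj-A2 j p q w p≢0 q≢0 p≢q =
  (λ e → p≢q (∷-injectiveˡ (++-cancelˡ (replicate j 0) _ _ e))) ,
  replicate j 0 ++ p ∷ [] , replicate j 0 ++ q ∷ [] , w ,
  sym (++-assoc (replicate j 0) (p ∷ []) w) , sym (++-assoc (replicate j 0) (q ∷ []) w) ,
  inj₂ (inj₂ (j , p , q , refl , refl , p≢0 , q≢0 , p≢q))

walk-∷ʳ : ∀ {ns d x y z} → Walk ns d x y → Adj y z → IsVertex ns z → Walk ns (suc d) x z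
walk-∷ʳ here         adj vz = step adj vz here
walk-∷ʳ (step a v w) adj vz = step a v (walk-∷ʳ w adj vz)

walk-reverse : ∀ {ns d x y} → IsVertex ns x → Walk ns d x y → Walk ns d y x
walk-reverse vx here            = here
walk-reverse vx (step adj vy w) = walk-∷ʳ (walk-reverse vy w) (adj-sym adj) vx

walk-++ : ∀ {ns d e x y z} → Walk ns d x y → Walk ns e y z → Walk ns (d + e) x z
walk-++ here         w′ = w′
walk-++ (step a v w) w′ = step a v (walk-++ w w′)

height-walk : ∀ {ns d x y} → Walk ns d x y → height y ≤ d + height x
height-walk here = ≤-refl
height-walk {d = suc d} (step adj _ w) =
  ≤-trans (height-walk w) (≤-trans (+-monoʳ-≤ d (height-lipschitz adj)) (≤-reflexive (+-suc d _)))

-- Changing whether the last letter is zero forces a visit to the root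

lastIsZeroOr-homogeneous : ∀ {β} d x a → Homogeneous β (x ∷ a) → lastIsZeroOr d (x ∷ a) ≡ β
lastIsZeroOr-homogeneous d x []      (x≡β ∷ []) = x≡β
lastIsZeroOr-homogeneous d x (y ∷ a) (_ ∷ h)    = lastIsZeroOr-homogeneous (isZero x) y a h

height-move-endsInZero : ∀ a b → Move a b → endsInZero b ≡ true → height b ≡ 0
height-move-endsInZero a b (inj₁ (p , zero , _ , refl , _)) _ = refl
height-move-endsInZero a b (inj₁ (p , suc q , _ , refl , _)) ()
height-move-endsInZero a b (inj₂ (inj₁ (inj₁ (_ , _ , _ , b≢0)))) eb = nonzeros b b≢0 eb
  where
  nonzeros : ∀ b → All (_≢ 0) b → endsInZero b ≡ true → height b ≡ 0
  nonzeros []      _   _  = refl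
  nonzeros (y ∷ b) b≢0 eb
    with () ← trans (sym eb) (lastIsZeroOr-homogeneous true y b (nonzeros-homogeneous b≢0))
height-move-endsInZero a b (inj₂ (inj₁ (inj₂ (_ , _ , b≡0 , _)))) _ = height-zeros b≡0
height-move-endsInZero a b (inj₂ (inj₂ (j , p , q , _ , refl , _ , q≢0 , _))) eb
  with () ← trans (sym eb) (trans (lastIsZeroOr-++ true (replicate j 0) (q ∷ [])) (isZero-≢0 q≢0))

crossing-edge : ∀ {u v} → Adj u v → endsInZero u ≡ false → endsInZero v ≡ true → height v ≡ 0
crossing-edge (_ , a , b , x ∷ w , refl , refl , _) eu ev
  with () ← trans (sym eu) (trans (lastIsZeroOr-++ true a (x ∷ w))
                                 (trans (sym (lastIsZeroOr-++ true b (x ∷ w))) ev))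
crossing-edge (_ , a , b , [] , refl , refl , mv) _ ev
  rewrite ++-identityʳ b = height-move-endsInZero a b mv ev

crossing : ∀ {ns d u y} → Walk ns d u y → endsInZero u ≡ false → endsInZero y ≡ true →
           height u + height y ≤ d
crossing here eu ey with () ← trans (sym eu) ey
crossing {d = suc d} {u} {y} (step {y = v} adj _ w) eu ey with endsInZero v in ev
... | false = ≤-trans (+-monoˡ-≤ (height y) (height-lipschitz (adj-sym adj))) (s≤s (crossing w ev ey))
... | true  = begin
  height u + height y              ≤⟨ +-mono-≤ (height-lipschitz (adj-sym adj)) (height-walk w) ⟩
  suc (height v) + (d + height v)  ≡⟨ cong (λ h → suc h + (d + h)) (crossing-edge adj eu ev) ⟩
  suc (d + 0)                      ≡⟨ cong suc (+-identityʳ d) ⟩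
  suc d                            ∎
  where open ≤-Reasoning

ʳ++-++ : ∀ (r u w : List ℕ) → (r ʳ++ u) ++ w ≡ r ʳ++ (u ++ w)
ʳ++-++ []      u w = refl
ʳ++-++ (x ∷ r) u w = ʳ++-++ r (x ∷ u) w

All-ʳ++ : ∀ {P : ℕ → Set} {r u} → All P r → All P u → All P (r ʳ++ u)
All-ʳ++ []       pu = pu
All-ʳ++ (p ∷ pr) pu = All-ʳ++ pr (p ∷ pu)

replicate-ʳ++ : ∀ n (u : List ℕ) → replicate n 0 ʳ++ u ≡ replicate n 0 ++ u
replicate-ʳ++ zero    u = refl
replicate-ʳ++ (suc n) u = trans (replicate-ʳ++ n (0 ∷ u)) (zeros-∷ n)
  where
  zeros-∷ : ∀ i → replicate i 0 ++ 0 ∷ u ≡ 0 ∷ replicate i 0 ++ u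
  zeros-∷ zero    = refl
  zeros-∷ (suc i) = cong (0 ∷_) (zeros-∷ i)

raise : ℕ → ℕ
raise zero    = 1
raise (suc x) = suc x

raise≢0 : ∀ x → raise x ≢ 0
raise≢0 zero    ()
raise≢0 (suc x) ()

adj-block : ∀ r x w → x ≢ 0 → Adj (replicate (length r) 0 ʳ++ 0 ∷ w) (map raise r ʳ++ x ∷ w)
adj-block r x w x≢0 =
  subst₂ Adj (ʳ++-++ (replicate (length r) 0) (0 ∷ []) w) (ʳ++-++ (map raise r) (x ∷ []) w)
    (adj-A1 _ _ w
      (≤-trans (s≤s z≤n) (≤-reflexive (sym (trans (length-ʳ++ (replicate (length r) 0)) (+-comm _ 1)))))
      (trans (length-ʳ++ (replicate (length r) 0))
        (trans (cong (_+ 1) (trans (length-replicate (length r)) (sym (length-map raise r))))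
               (sym (length-ʳ++ (map raise r)))))
      (All-ʳ++ (replicate⁺ (length r) refl) (refl ∷ []))
      (All-ʳ++ (map⁺ (universal raise≢0 r)) (x≢0 ∷ [])))

Within : ℕ → ℕ → Set
Within z t = z ≤ 1 ⊎ z ≡ t

within-< : ∀ {n z t} → 2 ≤ n → t < n → Within z t → z < n
within-< 2≤n _   (inj₁ z≤1)  = ≤-trans (s≤s z≤1) 2≤n
within-< _   t<n (inj₂ refl) = t<n

isVertex-within : ∀ {ns t v} → All (2 ≤_) ns → IsVertex ns t → Pointwise Within v t → IsVertex ns v
isVertex-within []           []         []          = []
isVertex-within (2≤n ∷ ns≥2) (t<n ∷ vt) (z~t ∷ v~t) = within-< 2≤n t<n z~t ∷ isVertex-within ns≥2 vt v~t

isVertex-small : ∀ {ns y} → All (2 ≤_) ns → length y ≡ length ns → All (_≤ 1) y → IsVertex ns y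
isVertex-small {[]}     {[]}    []           _  []           = []
isVertex-small {_ ∷ ns} {_ ∷ y} (2≤n ∷ ns≥2) ∣y∣≡∣ns∣ (z≤1 ∷ y≤1) =
  ≤-trans (s≤s z≤1) 2≤n ∷ isVertex-small ns≥2 (suc-injective ∣y∣≡∣ns∣) y≤1

root-isVertex : ∀ ns → All (2 ≤_) ns → IsVertex ns (root ns)
root-isVertex ns ns≥2 =
  isVertex-small ns≥2 (length-replicate (length ns)) (replicate⁺ (length ns) z≤n)

module Walks (ns : List ℕ) (ns≥2 : All (2 ≤_) ns) where

  zeros-isVertex : ∀ r w → IsVertex ns (r ʳ++ w) → IsVertex ns (replicate (length r) 0 ʳ++ w)
  zeros-isVertex r w v = isVertex-within ns≥2 v (ʳ++⁺ (zeros-within r) (Pointwise-refl (inj₂ refl)))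
    where
    zeros-within : ∀ r → Pointwise Within (replicate (length r) 0) r
    zeros-within []      = []
    zeros-within (_ ∷ r) = inj₁ z≤n ∷ zeros-within r

  raise-isVertex : ∀ r w → IsVertex ns (r ʳ++ w) → IsVertex ns (map raise r ʳ++ w)
  raise-isVertex r w v = isVertex-within ns≥2 v (ʳ++⁺ (raise-within r) (Pointwise-refl (inj₂ refl)))
    where
    raise-within : ∀ r → Pointwise Within (map raise r) r
    raise-within []          = []
    raise-within (zero ∷ r)  = inj₁ ≤-refl ∷ raise-within r
    raise-within (suc _ ∷ r) = inj₂ refl ∷ raise-within r

  climb₀ : ∀ r w → IsVertex ns (r ʳ++ w) →
           Walk ns (changesʳ true r) (replicate (length r) 0 ʳ++ w) (r ʳ++ w)
  climb₁ : ∀ r w → IsVertex ns (r ʳ++ w) →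
           Walk ns (changesʳ false r) (map raise r ʳ++ w) (r ʳ++ w)
  climb₀ []          w v = here
  climb₀ (zero ∷ r)  w v = climb₀ r (0 ∷ w) v
  climb₀ (suc x ∷ r) w v =
    step (adj-block r (suc x) w (λ ())) (raise-isVertex r (suc x ∷ w) v) (climb₁ r (suc x ∷ w) v)
  climb₁ []          w v = here
  climb₁ (suc x ∷ r) w v = climb₁ r (suc x ∷ w) v
  climb₁ (zero ∷ r)  w v =
    step (adj-sym (adj-block r 1 w (λ ()))) (zeros-isVertex r (0 ∷ w) v) (climb₀ r (0 ∷ w) v)

  walk-from-root : ∀ y → IsVertex ns y → Walk ns (height y) (root ns) y
  walk-from-root y vy = subst₂ (Walk ns (height y)) zeros≡root r≡y walk
    where
    r : List ℕ
    r = reverse y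
    r≡y : r ʳ++ [] ≡ y
    r≡y = reverse-involutive y
    zeros≡root : replicate (length r) 0 ʳ++ [] ≡ root ns
    zeros≡root = trans (replicate-ʳ++ _ []) (trans (++-identityʳ _)
                   (cong (λ n → replicate n 0) (trans (length-reverse y) (Pointwise-length vy))))
    walk : Walk ns (height y) (replicate (length r) 0 ʳ++ []) (r ʳ++ [])
    walk = subst (λ d → Walk ns d (replicate (length r) 0 ʳ++ []) (r ʳ++ []))
                 (trans (sym (height-reverse r)) (cong height r≡y))
                 (climb₀ r [] (subst (IsVertex ns) (sym r≡y) vy))

  dist-from-root : ∀ y → IsVertex ns y → IsDist ns (root ns) y (height y)
  dist-from-root y vy = walk-from-root y vy , λ d d<h walk → <⇒≱ d<h (begin
    height y                ≤⟨ height-walk walk ⟩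
    d + height (root ns)    ≡⟨ cong (d +_) (height-zeros (replicate⁺ (length ns) refl)) ⟩
    d + 0                   ≡⟨ +-identityʳ d ⟩
    d                       ∎)
    where open ≤-Reasoning

  walk-via-zeros : ∀ rx ry w → length rx ≡ length ry →
                   IsVertex ns (rx ʳ++ w) → IsVertex ns (ry ʳ++ w) →
                   Walk ns (changesʳ true rx + changesʳ true ry) (rx ʳ++ w) (ry ʳ++ w)
  walk-via-zeros rx ry w ∣rx∣≡∣ry∣ vx vy =
    walk-++ (walk-reverse (zeros-isVertex rx w vx) (climb₀ rx w vx))
            (subst (λ n → Walk ns _ (replicate n 0 ʳ++ w) _) (sym ∣rx∣≡∣ry∣) (climb₀ ry w vy))

  walk-swap : ∀ rx ry p q w → length rx ≡ length ry → p ≢ 0 → q ≢ 0 → p ≢ q →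
              IsVertex ns (rx ʳ++ p ∷ w) → IsVertex ns (ry ʳ++ q ∷ w) →
              Walk ns (changesʳ true rx + suc (changesʳ true ry)) (rx ʳ++ p ∷ w) (ry ʳ++ q ∷ w)
  walk-swap rx ry p q w ∣rx∣≡∣ry∣ p≢0 q≢0 p≢q vx vy =
    walk-++ (walk-reverse (zeros-isVertex rx (p ∷ w) vx) (climb₀ rx (p ∷ w) vx))
            (step (subst₂ Adj (sym (replicate-ʳ++ (length rx) (p ∷ w)))
                              (sym (replicate-ʳ++ (length rx) (q ∷ w)))
                              (adj-A2 (length rx) p q w p≢0 q≢0 p≢q))
                  (zeros {IsVertex ns} (zeros-isVertex ry (q ∷ w) vy))
                  (zeros {λ z → Walk ns (changesʳ true ry) z (ry ʳ++ q ∷ w)} (climb₀ ry (q ∷ w) vy)))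
    where
    zeros : ∀ {P : List ℕ → Set} → P (replicate (length ry) 0 ʳ++ q ∷ w) → P (replicate (length rx) 0 ʳ++ q ∷ w)
    zeros {P} = subst (λ n → P (replicate n 0 ʳ++ q ∷ w)) (sym ∣rx∣≡∣ry∣)

  -- a and b are the letters just before the common suffix w.
  walk-common-suffix : ∀ a rx b ry w → length rx ≡ length ry →
                       IsVertex ns (rx ʳ++ a ∷ w) → IsVertex ns (ry ʳ++ b ∷ w) →
                       Σ ℕ λ d → d ≤ length rx + suc (length rx) × Walk ns d (rx ʳ++ a ∷ w) (ry ʳ++ b ∷ w)
  walk-common-suffix zero rx b ry w ∣rx∣≡∣ry∣ vx vy =
    _ , +-mono-≤ (changesʳ≤length true rx)
                 (≤-trans (changesʳ≤length true (b ∷ ry)) (s≤s (≤-reflexive (sym ∣rx∣≡∣ry∣)))) ,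
    walk-via-zeros (zero ∷ rx) (b ∷ ry) w (cong suc ∣rx∣≡∣ry∣) vx vy
  walk-common-suffix (suc a) rx zero ry w ∣rx∣≡∣ry∣ vx vy =
    _ , ≤-trans (≤-reflexive (+-comm (changesʳ true (suc a ∷ rx)) _))
                (+-mono-≤ (≤-trans (changesʳ≤length true ry) (≤-reflexive (sym ∣rx∣≡∣ry∣)))
                          (changesʳ≤length true (suc a ∷ rx))) ,
    walk-via-zeros (suc a ∷ rx) (zero ∷ ry) w (cong suc ∣rx∣≡∣ry∣) vx vy
  walk-common-suffix (suc a) rx (suc b) ry w ∣rx∣≡∣ry∣ vx vy with a ≟ b
  walk-common-suffix (suc a) rx (suc b) ry w ∣rx∣≡∣ry∣ vx vy | no a≢b =
    _ , +-mono-≤ (changesʳ≤length true rx)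
                 (s≤s (≤-trans (changesʳ≤length true ry) (≤-reflexive (sym ∣rx∣≡∣ry∣)))) ,
    walk-swap rx ry (suc a) (suc b) w ∣rx∣≡∣ry∣ (λ ()) (λ ()) (λ e → a≢b (suc-injective e)) vx vy
  walk-common-suffix (suc a) [] (suc .a) [] w _ vx vy | yes refl = 0 , z≤n , here
  walk-common-suffix (suc a) (c ∷ rx) (suc .a) (e ∷ ry) w ∣rx∣≡∣ry∣ vx vy | yes refl
    with walk-common-suffix c rx e ry (suc a ∷ w) (suc-injective ∣rx∣≡∣ry∣) vx vy
  ... | d , d≤ , walk = d , ≤-trans d≤ (+-mono-≤ (n≤1+n _) (n≤1+n _)) , walk

  walk-between-reversed : ∀ rx ry → 1 ≤ length ns → length rx ≡ length ns → length ry ≡ length ns →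
                          IsVertex ns (rx ʳ++ []) → IsVertex ns (ry ʳ++ []) →
                          Σ ℕ λ d → d ≤ 2 * length ns ∸ 1 × Walk ns d (rx ʳ++ []) (ry ʳ++ [])
  walk-between-reversed [] _ 1≤∣ns∣ ∣rx∣ _ _ _ with () ← ≤-trans 1≤∣ns∣ (≤-reflexive (sym ∣rx∣))
  walk-between-reversed (_ ∷ _) [] 1≤∣ns∣ _ ∣ry∣ _ _ with () ← ≤-trans 1≤∣ns∣ (≤-reflexive (sym ∣ry∣))
  walk-between-reversed (a ∷ rx) (b ∷ ry) _ ∣rx∣ ∣ry∣ vx vy
    with walk-common-suffix a rx b ry [] (suc-injective (trans ∣rx∣ (sym ∣ry∣))) vx vy
  ... | d , d≤ , walk = d , ≤-trans d≤ (≤-reflexive bound) , walk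
    where
    bound : length rx + suc (length rx) ≡ 2 * length ns ∸ 1
    bound = trans (cong (λ t → length rx + suc t) (sym (+-identityʳ (length rx))))
                  (cong (λ t → 2 * t ∸ 1) ∣rx∣)

  walk-between : ∀ x y → 1 ≤ length ns → IsVertex ns x → IsVertex ns y →
                 Σ ℕ λ d → d ≤ 2 * length ns ∸ 1 × Walk ns d x y
  walk-between x y 1≤∣ns∣ vx vy
    with walk-between-reversed (reverse x) (reverse y) 1≤∣ns∣
           (trans (length-reverse x) (Pointwise-length vx)) (trans (length-reverse y) (Pointwise-length vy))
           (subst (IsVertex ns) (sym (reverse-involutive x)) vx)
           (subst (IsVertex ns) (sym (reverse-involutive y)) vy)
  ... | d , d≤ , walk = d , d≤ , subst₂ (Walk ns d) (reverse-involutive x) (reverse-involutive y) walk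

-- Shortest walks exist

least-witness : ∀ {P : ℕ → Set} → (∀ n → Dec (P n)) → ∀ n → P n →
                Σ ℕ λ m → m ≤ n × P m × (∀ m′ → m′ < m → ¬ P m′)
least-witness {P} P? = <-rec Goal search
  where
  Goal : ℕ → Set
  Goal n = P n → Σ ℕ λ m → m ≤ n × P m × (∀ m′ → m′ < m → ¬ P m′)
  search : ∀ n → (∀ {k} → k < n → Goal k) → Goal n
  search n rec pn with anyUpTo? P? n
  ... | yes (k , k<n , pk) with rec k<n pk
  ...   | m , m≤k , pm , minimal = m , ≤-trans m≤k (<⇒≤ k<n) , pm , minimal
  search n rec pn | no none = n , ≤-refl , pn , λ m′ m′<n pm′ → none (m′ , m′<n , pm′)

A0? : ∀ a b → Dec (A0 a b)
A0? (p ∷ []) (q ∷ []) with p ≟ q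
... | yes p≡q = no λ { (_ , _ , refl , refl , p≢q) → p≢q p≡q }
... | no p≢q  = yes (p , q , refl , refl , p≢q)
A0? []          _           = no λ { (_ , _ , () , _) }
A0? (_ ∷ _ ∷ _) _           = no λ { (_ , _ , () , _) }
A0? (_ ∷ [])    []          = no λ { (_ , _ , _ , () , _) }
A0? (_ ∷ [])    (_ ∷ _ ∷ _) = no λ { (_ , _ , _ , () , _) }

A1? : ∀ a b → Dec (A1 a b)
A1? a b = half a b ⊎-dec half b a
  where
  half : ∀ a b → Dec (A1half a b)
  half a b = (1 ≤? length a) ×-dec (length a ≟ length b) ×-dec
             all? (_≟ 0) a ×-dec all? (λ z → ¬? (z ≟ 0)) b

ZerosThen : ℕ → ℕ → List ℕ → Set
ZerosThen j p a = a ≡ replicate j 0 ++ p ∷ []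

zerosThen-[] : ∀ {j p} → ¬ ZerosThen j p []
zerosThen-[] {zero}  ()
zerosThen-[] {suc j} ()

zerosThen-singleton : ∀ {j p x} → ZerosThen j p (x ∷ []) → j ≡ 0 × x ≡ p
zerosThen-singleton {zero}  refl = refl , refl
zerosThen-singleton {suc j} e    = ⊥-elim (zerosThen-[] (∷-injectiveʳ e))

zerosThen-∷ : ∀ {j p x x′ a} → ZerosThen j p (x ∷ x′ ∷ a) →
              Σ ℕ λ i → j ≡ suc i × x ≡ 0 × ZerosThen i p (x′ ∷ a)
zerosThen-∷ {zero}  e with () ← ∷-injectiveʳ e
zerosThen-∷ {suc i} e = i , refl , ∷-injectiveˡ e , ∷-injectiveʳ e

A2? : ∀ a b → Dec (A2 a b)
A2? [] b = no λ { (_ , _ , _ , ea , _) → zerosThen-[] ea }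
A2? (x ∷ a) [] = no λ { (_ , _ , _ , _ , eb , _) → zerosThen-[] eb }
A2? (x ∷ []) (y ∷ []) with ¬? (x ≟ 0) ×-dec ¬? (y ≟ 0) ×-dec ¬? (x ≟ y)
... | yes conds = yes (0 , x , y , refl , refl , conds)
... | no ¬conds = no λ { (_ , _ , _ , ea , eb , conds) → ¬conds (singletons (zerosThen-singleton ea) (zerosThen-singleton eb) conds) }
  where
  singletons : ∀ {j p q} → j ≡ 0 × x ≡ p → j ≡ 0 × y ≡ q →
               p ≢ 0 × q ≢ 0 × p ≢ q → x ≢ 0 × y ≢ 0 × x ≢ y
  singletons (_ , refl) (_ , refl) conds = conds
A2? (x ∷ []) (y ∷ y′ ∷ b) = no λ { (_ , _ , _ , ea , eb , _) → lengths (zerosThen-singleton ea) (zerosThen-∷ eb) }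
  where
  lengths : ∀ {j p q} → j ≡ 0 × x ≡ p → ¬ Σ ℕ λ i → j ≡ suc i × y ≡ 0 × ZerosThen i q (y′ ∷ b)
  lengths (refl , _) (_ , () , _)
A2? (x ∷ x′ ∷ a) (y ∷ []) = no λ { (_ , _ , _ , ea , eb , _) → lengths (zerosThen-singleton eb) (zerosThen-∷ ea) }
  where
  lengths : ∀ {j p q} → j ≡ 0 × y ≡ q → ¬ Σ ℕ λ i → j ≡ suc i × x ≡ 0 × ZerosThen i p (x′ ∷ a)
  lengths (refl , _) (_ , () , _)
A2? (x ∷ x′ ∷ a) (y ∷ y′ ∷ b) with x ≟ 0 | y ≟ 0 | A2? (x′ ∷ a) (y′ ∷ b)
... | yes refl | yes refl | yes (j , p , q , ea , eb , conds) =
  yes (suc j , p , q , cong (0 ∷_) ea , cong (0 ∷_) eb , conds)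
... | no x≢0 | _ | _ = no λ { (_ , _ , _ , ea , _) → x≢0 (proj₁ (proj₂ (proj₂ (zerosThen-∷ ea)))) }
... | yes _ | no y≢0 | _ = no λ { (_ , _ , _ , _ , eb , _) → y≢0 (proj₁ (proj₂ (proj₂ (zerosThen-∷ eb)))) }
... | yes _ | yes _ | no ¬tail = no λ { (_ , _ , _ , ea , eb , conds) → tails (zerosThen-∷ ea) (zerosThen-∷ eb) conds }
  where
  tails : ∀ {j p q} → (Σ ℕ λ i → j ≡ suc i × x ≡ 0 × ZerosThen i p (x′ ∷ a)) →
          (Σ ℕ λ i → j ≡ suc i × y ≡ 0 × ZerosThen i q (y′ ∷ b)) → p ≢ 0 × q ≢ 0 × p ≢ q → ⊥
  tails (i , refl , _ , ea) (.i , refl , _ , eb) conds = ¬tail (i , _ , _ , ea , eb , conds)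

move? : ∀ a b → Dec (Move a b)
move? a b = A0? a b ⊎-dec A1? a b ⊎-dec A2? a b

SplitMove : List ℕ → List ℕ → Set
SplitMove x y = Σ (List ℕ) λ a → Σ (List ℕ) λ b → Σ (List ℕ) λ w →
  x ≡ a ++ w × y ≡ b ++ w × Move a b

take-length-++ : ∀ (a w : List ℕ) → take (length a) (a ++ w) ≡ a
take-length-++ []      w = refl
take-length-++ (x ∷ a) w = cong (x ∷_) (take-length-++ a w)

drop-length-++ : ∀ (a w : List ℕ) → drop (length a) (a ++ w) ≡ w
drop-length-++ []      w = refl
drop-length-++ (x ∷ a) w = drop-length-++ a w

-- Every split x = a ++ w is x = take i x ++ drop i x with i ≤ length x.
splitMove? : ∀ x y → Dec (SplitMove x y)
splitMove? x y = map′ to-split from-split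
  (anyUpTo? (λ i → anyUpTo? (λ j → ≡-dec _≟_ (drop i x) (drop j y) ×-dec move? (take i x) (take j y))
                             (suc (length y)))
            (suc (length x)))
  where
  to-split : (Σ ℕ λ i → i < suc (length x) × Σ ℕ λ j → j < suc (length y) ×
               drop i x ≡ drop j y × Move (take i x) (take j y)) → SplitMove x y
  to-split (i , _ , j , _ , same-suffix , mv) =
    take i x , take j y , drop i x , sym (take++drop≡id i x) ,
    trans (sym (take++drop≡id j y)) (cong (take j y ++_) (sym same-suffix)) , mv
  from-split : SplitMove x y → Σ ℕ λ i → i < suc (length x) × Σ ℕ λ j → j < suc (length y) ×
               drop i x ≡ drop j y × Move (take i x) (take j y)
  from-split (a , b , w , refl , refl , mv) =
    length a , s≤s (≤-trans (m≤m+n (length a) (length w)) (≤-reflexive (sym (length-++ a)))) ,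
    length b , s≤s (≤-trans (m≤m+n (length b) (length w)) (≤-reflexive (sym (length-++ b)))) ,
    trans (drop-length-++ a w) (sym (drop-length-++ b w)) ,
    subst₂ Move (sym (take-length-++ a w)) (sym (take-length-++ b w)) mv

adj? : ∀ x y → Dec (Adj x y)
adj? x y = ¬? (≡-dec _≟_ x y) ×-dec splitMove? x y

∃-vertex? : ∀ ns {P : List ℕ → Set} → (∀ y → Dec (P y)) → Dec (Σ (List ℕ) λ y → IsVertex ns y × P y)
∃-vertex? [] P? with P? []
... | yes p = yes ([] , [] , p)
... | no ¬p = no λ { ([] , [] , p) → ¬p p }
∃-vertex? (n ∷ ns) {P} P? =
  map′ (λ { (i , i<n , y , vy , p) → i ∷ y , i<n ∷ vy , p })
       (λ { (i ∷ y , i<n ∷ vy , p) → i , i<n , y , vy , p })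
       (anyUpTo? (λ i → ∃-vertex? ns (λ y → P? (i ∷ y))) n)

walk? : ∀ ns d x z → Dec (Walk ns d x z)
walk? ns zero x z with ≡-dec _≟_ x z
... | yes refl = yes here
... | no x≢z   = no λ { here → x≢z refl }
walk? ns (suc d) x z =
  map′ (λ { (y , vy , adj , walk) → step adj vy walk })
       (λ { (step adj vy walk) → _ , vy , adj , walk })
       (∃-vertex? ns (λ y → adj? x y ×-dec walk? ns d y z))

shortest-walk : ∀ {ns d x y} → Walk ns d x y → Σ ℕ λ d′ → d′ ≤ d × IsDist ns x y d′
shortest-walk {ns} {d} {x} {y} walk with least-witness (λ n → walk? ns n x y) d walk
... | d′ , d′≤d , walk′ , minimal = d′ , d′≤d , walk′ , minimal

zigzag : Bool → ℕ → List ℕ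
zigzag _     zero    = []
zigzag true  (suc n) = 0 ∷ zigzag false n
zigzag false (suc n) = 1 ∷ zigzag true n

changesʳ-zigzag : ∀ b n → changesʳ (not b) (zigzag b n) ≡ n
changesʳ-zigzag _     zero    = refl
changesʳ-zigzag true  (suc n) = cong suc (changesʳ-zigzag false n)
changesʳ-zigzag false (suc n) = cong suc (changesʳ-zigzag true n)

length-zigzag : ∀ b n → length (zigzag b n) ≡ n
length-zigzag _     zero    = refl
length-zigzag true  (suc n) = cong suc (length-zigzag false n)
length-zigzag false (suc n) = cong suc (length-zigzag true n)

zigzag≤1 : ∀ b n → All (_≤ 1) (zigzag b n)
zigzag≤1 _     zero    = []
zigzag≤1 true  (suc n) = z≤n ∷ zigzag≤1 false n
zigzag≤1 false (suc n) = ≤-refl ∷ zigzag≤1 true n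

module Eccentricities (n : ℕ) (ns′ : List ℕ) (ns≥2 : All (2 ≤_) (n ∷ ns′)) where

  open Walks (n ∷ ns′) ns≥2

  m : ℕ
  m = length ns′

  diameter : ℕ
  diameter = 2 * suc m ∸ 1

  high low : List ℕ
  high = reverse (zigzag false (suc m))
  low  = reverse (zigzag true (suc m))

  zigzag-isVertex : ∀ b → IsVertex (n ∷ ns′) (reverse (zigzag b (suc m)))
  zigzag-isVertex b = isVertex-small ns≥2
    (trans (length-reverse (zigzag b (suc m))) (length-zigzag b (suc m)))
    (All-ʳ++ (zigzag≤1 b (suc m)) [])

  height-high : height high ≡ suc m
  height-high = trans (height-reverse (zigzag false (suc m))) (changesʳ-zigzag false (suc m))

  height-low : height low ≡ m
  height-low = trans (height-reverse (zigzag true (suc m))) (changesʳ-zigzag false m)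

  high-ends-nonzero : endsInZero high ≡ false
  high-ends-nonzero = lastIsZeroOr-ʳ++ true (zigzag true m) 1 []

  low-ends-zero : endsInZero low ≡ true
  low-ends-zero = lastIsZeroOr-ʳ++ true (zigzag false m) 0 []

  root-ecc : IsEcc (n ∷ ns′) (root (n ∷ ns′)) (suc m)
  root-ecc =
    (λ y vy → height y , ≤-trans (height≤length y) (≤-reflexive (Pointwise-length vy)) , dist-from-root y vy) ,
    high , zigzag-isVertex false , subst (IsDist _ _ high) height-high (dist-from-root high (zigzag-isVertex false))

  ecc≥length : ∀ x e → IsVertex (n ∷ ns′) x → IsEcc (n ∷ ns′) x e → suc m ≤ e
  ecc≥length x e vx (ecc , _) with endsInZero x in ex
  ... | true with ecc high (zigzag-isVertex false)
  ...   | d , d≤e , walk , _ = begin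
    suc m                   ≡⟨ sym height-high ⟩
    height high             ≤⟨ m≤m+n (height high) (height x) ⟩
    height high + height x  ≤⟨ crossing (walk-reverse vx walk) high-ends-nonzero ex ⟩
    d                       ≤⟨ d≤e ⟩
    e                       ∎
    where open ≤-Reasoning
  ecc≥length x e vx (ecc , _) | false with ecc low (zigzag-isVertex true)
  ...   | d , d≤e , walk , _ = begin
    suc m                  ≤⟨ +-monoˡ-≤ m (endsInZero≡false⇒1≤height x ex) ⟩
    height x + m           ≡⟨ cong (height x +_) (sym height-low) ⟩
    height x + height low  ≤⟨ crossing walk ex low-ends-zero ⟩
    d                      ≤⟨ d≤e ⟩
    e                      ∎
    where open ≤-Reasoning

  high-low≡diameter : height high + height low ≡ diameter
  high-low≡diameter = begin
    height high + height low  ≡⟨ cong₂ _+_ height-high height-low ⟩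
    suc m + m                 ≡⟨ +-comm (suc m) m ⟩
    m + suc m                 ≡⟨ cong (λ t → m + suc t) (sym (+-identityʳ m)) ⟩
    diameter                  ∎
    where open ≡-Reasoning

  high-ecc : IsEcc (n ∷ ns′) high diameter
  high-ecc = farthest , low , zigzag-isVertex true , walk-high-low , shorter
    where
    farthest : ∀ y → IsVertex (n ∷ ns′) y → Σ ℕ λ d → d ≤ diameter × IsDist (n ∷ ns′) high y d
    farthest y vy with walk-between high y (s≤s z≤n) (zigzag-isVertex false) vy
    ... | d , d≤D , walk with shortest-walk walk
    ...   | d′ , d′≤d , dist = d′ , ≤-trans d′≤d d≤D , dist
    walk-high-low : Walk (n ∷ ns′) diameter high low
    walk-high-low = subst (λ d → Walk (n ∷ ns′) d high low) high-low≡diameter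
      (walk-++ (walk-reverse (root-isVertex (n ∷ ns′) ns≥2) (walk-from-root high (zigzag-isVertex false)))
               (walk-from-root low (zigzag-isVertex true)))
    shorter : ∀ d → d < diameter → ¬ Walk (n ∷ ns′) d high low
    shorter d d<D walk = <⇒≱ d<D (≤-trans (≤-reflexive (sym high-low≡diameter))
                                           (crossing walk high-ends-nonzero low-ends-zero))

  ecc≤diameter : ∀ x e → IsVertex (n ∷ ns′) x → IsEcc (n ∷ ns′) x e → e ≤ diameter
  ecc≤diameter x e vx (_ , y , vy , _ , minimal) with walk-between x y (s≤s z≤n) vx vy
  ... | d , d≤D , walk = ≤-trans (≮⇒≥ (λ d<e → minimal d d<e walk)) d≤D

mainTheorem7 : (ns : List ℕ) → 1 ≤ length ns → All (2 ≤_) ns →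
    IsEcc ns (root ns) (length ns) × IsRadius ns (length ns) ×
      IsDiameter ns (2 * length ns ∸ 1)
mainTheorem7 (n ∷ ns′) _ ns≥2 =
  root-ecc ,
  ((root (n ∷ ns′) , root-isVertex (n ∷ ns′) ns≥2 , root-ecc) , ecc≥length) ,
  ((high , zigzag-isVertex false , high-ecc) , ecc≤diameter)
  where open Eccentricities n ns′ ns≥2
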